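{- Let $\mathcal M,\mathcal N,\mathcal K,\mathcal G$ be structures such that: $\mathcal M$ is a retract of $\mathcal N$ via a retraction $(\mathsf N_{\mathcal M},\mathsf M_{\mathcal N})$ (with $\mathcal N\cong\mathcal M^{\mathsf N_{\mathcal M}}$); $\mathcal M$ is bi-interpretable with $\mathcal K$ via a bi-interpretation $(\mathsf K_{\mathcal M},\mathsf M_{\mathcal K})$ (with $\mathcal K\cong\mathcal M^{\mathsf K_{\mathcal M}}$); and $\mathcal N$ is a retract of $\mathcal G$ via a retraction $(\mathsf G_{\mathcal N},\mathsf N_{\mathcal G})$ (with $\mathcal G\cong\mathcal N^{\mathsf G_{\mathcal N}}$). Then $\mathcal K$ is a retract of $\mathcal G$. Moreover, the retraction $(\mathsf G_{\mathcal K},\mathsf K_{\mathcal G})$ witnessing this (with $\mathsf G_{\mathcal K}$ an interpretation in $\mathcal M^{\mathsf K_{\mathcal M}}$) can be chosen so that there is an $\mathcal M$-definable isomorphism between the structure obtained from $\mathcal M$ by applying $\mathsf N_{\mathcal M}$ and then $\mathsf G_{\mathcal N}$ and the structure obtained from $\mathcal M$ by applying $\mathsf K_{\mathcal M}$ and then $\mathsf G_{\mathcal K}$.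
   Context: Interpretations in structures are one-dimensional and may use parameters; an interpretation $\mathsf N$ in $\mathcal M$ (formulas for domain, equality as a congruence, and relations) yields $\mathcal M^{\mathsf N}$; interpretations compose, and an isomorphism of the interpreted structures transports interpretations with parameters. A pair $(\mathsf N,\mathsf M)$ ($\mathsf N$ in $\mathcal M$, $\mathsf M$ in $\mathcal M^{\mathsf N}$) is a retraction in $\mathcal M$ if there is an $\mathcal M$-definable isomorphism $\iota$ between $\mathcal M$ and $(\mathcal M^{\mathsf N})^{\mathsf M}$; it is a bi-interpretation in $\mathcal M$ if moreover there is an $\mathcal M^{\mathsf N}$-definable isomorphism between $\mathcal M^{\mathsf N}$ and the structure obtained by applying, in $(\mathcal M^{\mathsf N})^{\mathsf M}$, the interpretation $\mathsf N$ with parameters moved by $\iota$. $\mathcal M$ is a retract of (resp. bi-interpretable with) $\mathcal N$ if there is a retraction (resp. bi-interpretation) $(\mathsf N,\mathsf M)$ in $\mathcal M$ with $\mathcal M^{\mathsf N}\cong\mathcal N$. -}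

module Defs where

open import Level using (Level; Lift; suc; 0ℓ) renaming (_⊔_ to _⊔ℓ_)
open import Data.Nat using (ℕ; _+_) renaming (suc to sucℕ)
open import Data.Fin using (Fin)
open import Data.Product using (Σ; _×_; _,_; proj₁; proj₂)
open import Data.Sum using (_⊎_)
open import Data.Unit using (⊤)
open import Data.Empty using (⊥)
open import Data.Vec.Functional using (Vector; _∷_; _++_)
open import Function using (_∘_; id)
open import Relation.Binary using (IsEquivalence)

record Signature : Set₁ where
  field
    Sym   : Set
    arity : Sym → ℕ
open Signature public

-- Equality of the structure is a setoid equality _≈_
-- (needed since interpreted structures are quotients by a definable
-- congruence, and Agda has no quotient types); relations respect it.

record Structure (σ : Signature) (ℓ : Level) : Set (suc ℓ) where
  field
    Carrier : Set ℓ
    _≈_     : Carrier → Carrier → Set ℓ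
    isEquivalence : IsEquivalence _≈_
    rel     : (R : Sym σ) → Vector Carrier (arity σ R) → Set ℓ
    rel-cong : (R : Sym σ) (xs ys : Vector Carrier (arity σ R)) →
               (∀ i → xs i ≈ ys i) → rel R xs → rel R ys
open Structure public

data Formula (σ : Signature) : ℕ → Set where
  relf : ∀ {n} (R : Sym σ) → (Fin (arity σ R) → Fin n) → Formula σ n
  _≐_  : ∀ {n} → Fin n → Fin n → Formula σ n
  ⊤f   : ∀ {n} → Formula σ n
  ⊥f   : ∀ {n} → Formula σ n
  ¬f   : ∀ {n} → Formula σ n → Formula σ n
  _∧f_ : ∀ {n} → Formula σ n → Formula σ n → Formula σ n
  _∨f_ : ∀ {n} → Formula σ n → Formula σ n → Formula σ n
  _⇒f_ : ∀ {n} → Formula σ n → Formula σ n → Formula σ n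
  ∀f   : ∀ {n} → Formula σ (sucℕ n) → Formula σ n
  ∃f   : ∀ {n} → Formula σ (sucℕ n) → Formula σ n

-- Tarski satisfaction (variable 0 is bound by the innermost quantifier).
Sat : ∀ {σ ℓ} (M : Structure σ ℓ) {n} → Formula σ n →
      Vector (Carrier M) n → Set ℓ
Sat M (relf R f) ρ = rel M R (ρ ∘ f)
Sat M (i ≐ j)   ρ = _≈_ M (ρ i) (ρ j)
Sat {ℓ = ℓ} M ⊤f ρ = Lift ℓ ⊤
Sat {ℓ = ℓ} M ⊥f ρ = Lift ℓ ⊥
Sat {ℓ = ℓ} M (¬f φ) ρ = Sat M φ ρ → Lift ℓ ⊥
Sat M (φ ∧f ψ) ρ = Sat M φ ρ × Sat M ψ ρ
Sat M (φ ∨f ψ) ρ = Sat M φ ρ ⊎ Sat M ψ ρ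
Sat M (φ ⇒f ψ) ρ = Sat M φ ρ → Sat M ψ ρ
Sat M (∀f φ) ρ = (a : Carrier M) → Sat M φ (a ∷ ρ)
Sat M (∃f φ) ρ = Σ (Carrier M) λ a → Sat M φ (a ∷ ρ)

-- One-dimensional interpretations of τ in σ, with `params` parameters.
-- Parameter variables come after the object variables.

record Interp (σ τ : Signature) : Set where
  field
    params : ℕ
    dom    : Formula σ (sucℕ params)
    eq     : Formula σ (sucℕ (sucℕ params))
    rels   : (R : Sym τ) → Formula σ (arity τ R + params)
open Interp public

record IsInterpIn {σ τ ℓ} (M : Structure σ ℓ) (I : Interp σ τ)
                  (p : Vector (Carrier M) (params I)) : Set ℓ where
  D : Carrier M → Set ℓ
  D a = Sat M (dom I) (a ∷ p)
  E : Carrier M → Carrier M → Set ℓ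
  E a b = Sat M (eq I) (a ∷ b ∷ p)
  field
    E-refl  : ∀ a → D a → E a a
    E-sym   : ∀ a b → D a → D b → E a b → E b a
    E-trans : ∀ a b c → D a → D b → D c → E a b → E b c → E a c
    rels-cong : (R : Sym τ) (xs ys : Vector (Carrier M) (arity τ R)) →
                (∀ i → D (xs i)) → (∀ i → D (ys i)) →
                (∀ i → E (xs i) (ys i)) →
                Sat M (rels I R) (xs ++ p) → Sat M (rels I R) (ys ++ p)

record InterpIn {σ ℓ} (M : Structure σ ℓ) (τ : Signature) : Set ℓ where
  field
    interp : Interp σ τ
    pars   : Vector (Carrier M) (params interp)
    isInterp : IsInterpIn M interp pars
open InterpIn public

applyWith : ∀ {σ τ ℓ} (M : Structure σ ℓ) (I : Interp σ τ)
            (p : Vector (Carrier M) (params I)) → IsInterpIn M I p →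
            Structure τ ℓ
applyWith M I p h = record
  { Carrier = Σ (Carrier M) D
  ; _≈_ = λ x y → E (proj₁ x) (proj₁ y)
  ; isEquivalence = record
      { refl  = λ {x} → E-refl (proj₁ x) (proj₂ x)
      ; sym   = λ {x} {y} → E-sym (proj₁ x) (proj₁ y) (proj₂ x) (proj₂ y)
      ; trans = λ {x} {y} {z} → E-trans (proj₁ x) (proj₁ y) (proj₁ z)
                                        (proj₂ x) (proj₂ y) (proj₂ z) }
  ; rel = λ R xs → Sat M (rels I R) ((proj₁ ∘ xs) ++ p)
  ; rel-cong = λ R xs ys e → rels-cong R (proj₁ ∘ xs) (proj₁ ∘ ys)
                                (proj₂ ∘ xs) (proj₂ ∘ ys) e
  }
  where open IsInterpIn h

_^_ : ∀ {σ τ ℓ} (M : Structure σ ℓ) → InterpIn M τ → Structure τ ℓ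
M ^ N = applyWith M (interp N) (pars N) (isInterp N)

record Iso {τ ℓ} (A B : Structure τ ℓ) : Set ℓ where
  field
    to       : Carrier A → Carrier B
    to-cong  : ∀ {x y} → _≈_ A x y → _≈_ B (to x) (to y)
    to-inj   : ∀ {x y} → _≈_ B (to x) (to y) → _≈_ A x y
    to-surj  : ∀ y → Σ (Carrier A) λ x → _≈_ B (to x) y
    to-rel   : (R : Sym τ) (xs : Vector (Carrier A) (arity τ R)) →
               rel A R xs → rel B R (to ∘ xs)
    from-rel : (R : Sym τ) (xs : Vector (Carrier A) (arity τ R)) →
               rel B R (to ∘ xs) → rel A R xs
open Iso public

_≅_ : ∀ {τ ℓ} (A B : Structure τ ℓ) → Set ℓ
A ≅ B = Iso A B

-- An isomorphism f : X → Y between structures whose elements are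
-- represented by elements of A (via uX, uY) is A-definable if its graph
-- is defined in A by a formula with parameters from A.
DefinableIso : ∀ {σ τ ℓ} (A : Structure σ ℓ) {X Y : Structure τ ℓ}
               (uX : Carrier X → Carrier A) (uY : Carrier Y → Carrier A) →
               Iso X Y → Set ℓ
DefinableIso {σ} A {X} {Y} uX uY f =
  Σ ℕ λ k → Σ (Formula σ (sucℕ (sucℕ k))) λ θ →
  Σ (Vector (Carrier A) k) λ q →
  (x : Carrier X) (y : Carrier Y) →
  (_≈_ Y (to f x) y → Sat A θ (uX x ∷ uY y ∷ q)) ×
  (Sat A θ (uX x ∷ uY y ∷ q) → _≈_ Y (to f x) y)

under₂ : ∀ {σ τ ρ ℓ} {M : Structure σ ℓ} {N : InterpIn M τ}
         {K : InterpIn (M ^ N) ρ} → Carrier ((M ^ N) ^ K) → Carrier M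
under₂ y = proj₁ (proj₁ y)

record Retraction {σ ℓ} (M : Structure σ ℓ) (τ : Signature) : Set ℓ where
  field
    N  : InterpIn M τ
    M′ : InterpIn (M ^ N) σ
    ι  : Iso M ((M ^ N) ^ M′)
    ι-definable : DefinableIso M id (under₂ {M = M} {N = N} {K = M′}) ι
open Retraction public

record BiInterpretation {σ ℓ} (M : Structure σ ℓ) (τ : Signature) : Set ℓ where
  field
    retraction : Retraction M τ
  private
    Nᵣ = Retraction.N retraction
    M′ᵣ = Retraction.M′ retraction
    ιᵣ = Retraction.ι retraction
  -- N with its parameters moved by ι, as an interpretation in (M^N)^M'
  -- (that this is an interpretation is automatic, recorded as a field)
  field
    moved-isInterp : IsInterpIn ((M ^ Nᵣ) ^ M′ᵣ) (interp Nᵣ) (to ιᵣ ∘ pars Nᵣ)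
  movedN : InterpIn ((M ^ Nᵣ) ^ M′ᵣ) τ
  movedN = record { interp = interp Nᵣ ; pars = to ιᵣ ∘ pars Nᵣ
                  ; isInterp = moved-isInterp }
  field
    κ : Iso (M ^ Nᵣ) (((M ^ Nᵣ) ^ M′ᵣ) ^ movedN)
    κ-definable : DefinableIso (M ^ Nᵣ) id
                    (under₂ {M = (M ^ Nᵣ)} {N = M′ᵣ} {K = movedN}) κ
open BiInterpretation public

{-# OPTIONS --safe #-}
module Submission where

-- Retractions compose and can be transported along isomorphisms; in both cases the
-- new ι is a composite of definable isomorphisms, hence definable. Composing
-- (N_M, M_N) with (G_N, N_G) gives a retraction of M onto G. Transport it along the
-- M-definable isomorphism M ≅ (M^K_M)^M_K and put the retraction (M_K, K_M) of
-- M^K_M, which the bi-interpretation provides, in front of it: the result is the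
-- retraction of K. The isomorphism between the two interpretations of G is the
-- composite of the canonical isomorphisms met along the way, each definable in M.

open import Level using (Level; lift)
open import Data.Nat using (ℕ; _+_)
open import Data.Fin as Fin using (Fin; zero; suc; splitAt; join; _↑ˡ_; _↑ʳ_)
open import Data.Product using (Σ; _×_; proj₁; proj₂; _,_)
open import Data.Product.Function.NonDependent.Propositional using (_×-⇔_)
open import Data.Sum using (inj₁; inj₂; map₁)
open import Data.Sum.Function.Propositional using (_⊎-⇔_)
open import Data.Unit using (tt)
open import Data.Vec.Functional using (Vector; _∷_; _++_; [])
open import Data.Vec.Functional.Properties using (lookup-++ˡ; lookup-++ʳ; ++-cong)
open import Data.Vec.Functional.Relation.Binary.Pointwise using (Pointwise)
open import Data.Vec.Functional.Relation.Binary.Pointwise.Properties using (++⁺)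
open import Function using (_∘_; id; _⇔_; mk⇔; Equivalence)
open import Function.Construct.Composition using (_⇔-∘_)
open import Function.Construct.Symmetry using (⇔-sym)
open import Function.Related.TypeIsomorphisms using (→-cong-⇔)
open import Relation.Binary using (IsEquivalence)
open import Relation.Binary.PropositionalEquality as ≡ using (_≗_; refl)
open import Defs

module ⇔ = Equivalence
module Eq {σ : Signature} {ℓ : Level} (M : Structure σ ℓ) = IsEquivalence (isEquivalence M)

⇔-refl : ∀ {a} {A : Set a} → A ⇔ A
⇔-refl = mk⇔ id id

Π-cong-⇔ : ∀ {a p q} {A : Set a} {P : A → Set p} {Q : A → Set q} →
           (∀ x → P x ⇔ Q x) → (∀ x → P x) ⇔ (∀ x → Q x)
Π-cong-⇔ e = mk⇔ (λ f x → ⇔.to (e x) (f x)) (λ g x → ⇔.from (e x) (g x))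

Σ-cong-⇔ : ∀ {a p q} {A : Set a} {P : A → Set p} {Q : A → Set q} →
           (∀ x → P x ⇔ Q x) → Σ A P ⇔ Σ A Q
Σ-cong-⇔ e = mk⇔ (λ (x , p) → x , ⇔.to (e x) p) (λ (x , q) → x , ⇔.from (e x) q)

module _ {a} {A : Set a} where

  ++-singleton : ∀ {n} (v : Vector A 1) (w : Vector A n) → v ++ w ≗ v zero ∷ w
  ++-singleton v w zero    = refl
  ++-singleton v w (suc i) = refl

  ++-pair : ∀ {n} (v : Vector A 2) (w : Vector A n) → v ++ w ≗ v zero ∷ v (suc zero) ∷ w
  ++-pair v w zero          = refl
  ++-pair v w (suc zero)    = refl
  ++-pair v w (suc (suc i)) = refl

  ∷-++ : ∀ {m n} (x : A) (v : Vector A m) (w : Vector A n) → (x ∷ v) ++ w ≗ x ∷ (v ++ w)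
  ∷-++ x v w zero = refl
  ∷-++ {m} x v w (suc i) with splitAt m i
  ... | inj₁ _ = refl
  ... | inj₂ _ = refl

  ∘-∷ : ∀ {b n} {B : Set b} (g : A → B) (x : A) (v : Vector A n) →
        g ∘ (x ∷ v) ≗ g x ∷ (g ∘ v)
  ∘-∷ g x v zero    = refl
  ∘-∷ g x v (suc i) = refl

  map-++ : ∀ {b m n} {B : Set b} (g : A → B) (v : Vector A m) (w : Vector A n) →
           g ∘ (v ++ w) ≗ (g ∘ v) ++ (g ∘ w)
  map-++ {m = m} g v w i with splitAt m i
  ... | inj₁ _ = refl
  ... | inj₂ _ = refl

withParams : ∀ {a n} → (Fin a → Fin n) → ∀ k → Fin (a + k) → Fin (n + k)
withParams {a} {n} f k = join n k ∘ map₁ f ∘ splitAt a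

withParams-++ : ∀ {c a n k} {C : Set c} (f : Fin a → Fin n) (v : Vector C n) (w : Vector C k) →
                (v ++ w) ∘ withParams f k ≗ (v ∘ f) ++ w
withParams-++ {a = a} f v w i with splitAt a i
... | inj₁ j = lookup-++ˡ v w (f j)
... | inj₂ j = lookup-++ʳ v w j

reassoc : ∀ m n k → Fin ((m + n) + k) → Fin (m + (n + k))
reassoc m n k i with splitAt (m + n) i
... | inj₂ c = m ↑ʳ (n ↑ʳ c)
... | inj₁ ab with splitAt m ab
...   | inj₁ a = a ↑ˡ (n + k)
...   | inj₂ b = m ↑ʳ (b ↑ˡ k)

reassoc-++ : ∀ {c m n k} {C : Set c} (u : Vector C m) (v : Vector C n) (w : Vector C k) →
             (u ++ (v ++ w)) ∘ reassoc m n k ≗ (u ++ v) ++ w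
reassoc-++ {m = m} {n} {k} u v w i with splitAt (m + n) i
... | inj₂ c = ≡.trans (lookup-++ʳ u (v ++ w) (n ↑ʳ c)) (lookup-++ʳ v w c)
... | inj₁ ab with splitAt m ab
...   | inj₁ a = lookup-++ˡ u (v ++ w) a
...   | inj₂ b = ≡.trans (lookup-++ʳ u (v ++ w) (b ↑ˡ k)) (lookup-++ˡ v w b)

rename : ∀ {σ n m} → (Fin n → Fin m) → Formula σ n → Formula σ m
rename r (relf R f) = relf R (r ∘ f)
rename r (i ≐ j)    = r i ≐ r j
rename r ⊤f         = ⊤f
rename r ⊥f         = ⊥f
rename r (¬f φ)     = ¬f (rename r φ)
rename r (φ ∧f ψ)   = rename r φ ∧f rename r ψ
rename r (φ ∨f ψ)   = rename r φ ∨f rename r ψ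
rename r (φ ⇒f ψ)   = rename r φ ⇒f rename r ψ
rename r (∀f φ)     = ∀f (rename (Fin.lift 1 r) φ)
rename r (∃f φ)     = ∃f (rename (Fin.lift 1 r) φ)

insertAfterHead : ∀ {σ k} m → Formula σ (1 + k) → Formula σ (1 + (m + k))
insertAfterHead m = rename (Fin.lift 1 (m ↑ʳ_))

module _ {σ : Signature} {ℓ : Level} (M : Structure σ ℓ) where

  Pointwise-∷ : ∀ {n x y} {ρ ρ′ : Vector (Carrier M) n} → _≈_ M x y →
                Pointwise (_≈_ M) ρ ρ′ → Pointwise (_≈_ M) (x ∷ ρ) (y ∷ ρ′)
  Pointwise-∷ e es zero    = e
  Pointwise-∷ e es (suc i) = es i

  Pointwise-lift : ∀ {n m} (r : Fin n → Fin m) {a} {ρ : Vector (Carrier M) m} {ρ′} →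
                   Pointwise (_≈_ M) (ρ ∘ r) ρ′ →
                   Pointwise (_≈_ M) ((a ∷ ρ) ∘ Fin.lift 1 r) (a ∷ ρ′)
  Pointwise-lift r e zero    = Eq.refl M
  Pointwise-lift r e (suc i) = e i

  Sat-cong : ∀ {n} (φ : Formula σ n) {ρ ρ′} →
             Pointwise (_≈_ M) ρ ρ′ → Sat M φ ρ → Sat M φ ρ′
  Sat-cong (relf R f) e          = rel-cong M R _ _ (e ∘ f)
  Sat-cong (i ≐ j)    e s        = Eq.trans M (Eq.sym M (e i)) (Eq.trans M s (e j))
  Sat-cong ⊤f         e s        = s
  Sat-cong ⊥f         e s        = s
  Sat-cong (¬f φ)     e s        = s ∘ Sat-cong φ (Eq.sym M ∘ e)
  Sat-cong (φ ∧f ψ)   e (s , t)  = Sat-cong φ e s , Sat-cong ψ e t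
  Sat-cong (φ ∨f ψ)   e (inj₁ s) = inj₁ (Sat-cong φ e s)
  Sat-cong (φ ∨f ψ)   e (inj₂ t) = inj₂ (Sat-cong ψ e t)
  Sat-cong (φ ⇒f ψ)   e s        = Sat-cong ψ e ∘ s ∘ Sat-cong φ (Eq.sym M ∘ e)
  Sat-cong (∀f φ)     e s a      = Sat-cong φ (Pointwise-∷ (Eq.refl M) e) (s a)
  Sat-cong (∃f φ)     e (a , s)  = a , Sat-cong φ (Pointwise-∷ (Eq.refl M) e) s

  Sat-cong-⇔ : ∀ {n} (φ : Formula σ n) {ρ ρ′} →
               Pointwise (_≈_ M) ρ ρ′ → Sat M φ ρ ⇔ Sat M φ ρ′
  Sat-cong-⇔ φ e = mk⇔ (Sat-cong φ e) (Sat-cong φ (Eq.sym M ∘ e))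

  Sat-≗ : ∀ {n} (φ : Formula σ n) {ρ ρ′} → ρ ≗ ρ′ → Sat M φ ρ ⇔ Sat M φ ρ′
  Sat-≗ φ e = Sat-cong-⇔ φ (Eq.reflexive M ∘ e)

  Sat-cong₁ : ∀ {k} (φ : Formula σ (1 + k)) {a a′} {q : Vector (Carrier M) k} →
              _≈_ M a a′ → Sat M φ (a ∷ q) → Sat M φ (a′ ∷ q)
  Sat-cong₁ φ a≈a′ = Sat-cong φ (Pointwise-∷ a≈a′ λ _ → Eq.refl M)

  Sat-cong₂ : ∀ {k} (φ : Formula σ (2 + k)) {a a′ b b′} {q : Vector (Carrier M) k} →
              _≈_ M a a′ → _≈_ M b b′ → Sat M φ (a ∷ b ∷ q) → Sat M φ (a′ ∷ b′ ∷ q)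
  Sat-cong₂ φ a≈a′ b≈b′ = Sat-cong φ (Pointwise-∷ a≈a′ (Pointwise-∷ b≈b′ λ _ → Eq.refl M))

  Sat-rename : ∀ {n m} (r : Fin n → Fin m) (φ : Formula σ n) {ρ ρ′} →
               Pointwise (_≈_ M) (ρ ∘ r) ρ′ → Sat M (rename r φ) ρ ⇔ Sat M φ ρ′
  Sat-rename r (relf R f) e = Sat-cong-⇔ (relf R f) e
  Sat-rename r (i ≐ j)    e = Sat-cong-⇔ (i ≐ j) e
  Sat-rename r ⊤f         e = ⇔-refl
  Sat-rename r ⊥f         e = ⇔-refl
  Sat-rename r (¬f φ)     e = →-cong-⇔ (Sat-rename r φ e) ⇔-refl
  Sat-rename r (φ ∧f ψ)   e = Sat-rename r φ e ×-⇔ Sat-rename r ψ e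
  Sat-rename r (φ ∨f ψ)   e = Sat-rename r φ e ⊎-⇔ Sat-rename r ψ e
  Sat-rename r (φ ⇒f ψ)   e = →-cong-⇔ (Sat-rename r φ e) (Sat-rename r ψ e)
  Sat-rename r (∀f φ)     e = Π-cong-⇔ λ a → Sat-rename (Fin.lift 1 r) φ (Pointwise-lift r e)
  Sat-rename r (∃f φ)     e = Σ-cong-⇔ λ a → Sat-rename (Fin.lift 1 r) φ (Pointwise-lift r e)

  Sat-insertAfterHead : ∀ {m k} (φ : Formula σ (1 + k)) a (v : Vector (Carrier M) m) w →
                        Sat M (insertAfterHead m φ) (a ∷ (v ++ w)) ⇔ Sat M φ (a ∷ w)
  Sat-insertAfterHead {m} φ a v w =
    Sat-rename _ φ (Pointwise-lift (m ↑ʳ_) (Eq.reflexive M ∘ lookup-++ʳ v w))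

module _ {τ : Signature} {ℓ : Level} where

  ≅-refl : {X : Structure τ ℓ} → X ≅ X
  ≅-refl {X} = record
    { to = id ; to-cong = id ; to-inj = id ; to-surj = λ x → x , Eq.refl X
    ; to-rel = λ _ _ → id ; from-rel = λ _ _ → id }

  ≅-trans : {X Y Z : Structure τ ℓ} → X ≅ Y → Y ≅ Z → X ≅ Z
  ≅-trans {Z = Z} f g = record
    { to       = to g ∘ to f
    ; to-cong  = to-cong g ∘ to-cong f
    ; to-inj   = to-inj f ∘ to-inj g
    ; to-surj  = λ z → let (y , gy≈z) = to-surj g z ; (x , fx≈y) = to-surj f y
                       in x , Eq.trans Z (to-cong g fx≈y) gy≈z
    ; to-rel   = λ R xs → to-rel g R (to f ∘ xs) ∘ to-rel f R xs
    ; from-rel = λ R xs → from-rel f R xs ∘ from-rel g R (to f ∘ xs)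
    }

  ≅-sym : {X Y : Structure τ ℓ} → X ≅ Y → Y ≅ X
  ≅-sym {X} {Y} f = record
    { to       = from
    ; to-cong  = λ {y} {y′} y≈y′ →
                   to-inj f (Eq.trans Y (to-from y) (Eq.trans Y y≈y′ (Eq.sym Y (to-from y′))))
    ; to-inj   = λ {y} {y′} e →
                   Eq.trans Y (Eq.sym Y (to-from y)) (Eq.trans Y (to-cong f e) (to-from y′))
    ; to-surj  = λ x → to f x , to-inj f (to-from (to f x))
    ; to-rel   = λ R ys r → from-rel f R (from ∘ ys) (rel-cong Y R ys _ (Eq.sym Y ∘ to-from ∘ ys) r)
    ; from-rel = λ R ys r → rel-cong Y R _ ys (to-from ∘ ys) (to-rel f R (from ∘ ys) r)
    }
    where
      from : Carrier Y → Carrier X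
      from y = proj₁ (to-surj f y)
      to-from : ∀ y → _≈_ Y (to f (from y)) y
      to-from y = proj₂ (to-surj f y)

module _ {τ : Signature} {ℓ : Level} {X Y : Structure τ ℓ} (f : X ≅ Y) where

  private
    to-∷ : ∀ {n} x y (ρ : Vector (Carrier X) n) → _≈_ Y (to f x) y →
           Pointwise (_≈_ Y) (to f ∘ (x ∷ ρ)) (y ∷ (to f ∘ ρ))
    to-∷ x y ρ e zero    = e
    to-∷ x y ρ e (suc i) = Eq.refl Y

  Sat-≅ : ∀ {n} (φ : Formula τ n) (ρ : Vector (Carrier X) n) → Sat X φ ρ ⇔ Sat Y φ (to f ∘ ρ)
  Sat-≅ (relf R g) ρ = mk⇔ (to-rel f R (ρ ∘ g)) (from-rel f R (ρ ∘ g))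
  Sat-≅ (i ≐ j)    ρ = mk⇔ (to-cong f) (to-inj f)
  Sat-≅ ⊤f         ρ = ⇔-refl
  Sat-≅ ⊥f         ρ = ⇔-refl
  Sat-≅ (¬f φ)     ρ = →-cong-⇔ (Sat-≅ φ ρ) ⇔-refl
  Sat-≅ (φ ∧f ψ)   ρ = Sat-≅ φ ρ ×-⇔ Sat-≅ ψ ρ
  Sat-≅ (φ ∨f ψ)   ρ = Sat-≅ φ ρ ⊎-⇔ Sat-≅ ψ ρ
  Sat-≅ (φ ⇒f ψ)   ρ = →-cong-⇔ (Sat-≅ φ ρ) (Sat-≅ ψ ρ)
  Sat-≅ (∀f φ)     ρ = mk⇔
    (λ s y → let (x , fx≈y) = to-surj f y in
             Sat-cong Y φ (to-∷ x y ρ fx≈y) (⇔.to (Sat-≅ φ (x ∷ ρ)) (s x)))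
    (λ s x → ⇔.from (Sat-≅ φ (x ∷ ρ))
               (Sat-cong Y φ (Eq.sym Y ∘ to-∷ x _ ρ (Eq.refl Y)) (s (to f x))))
  Sat-≅ (∃f φ)     ρ = mk⇔
    (λ (x , s) → to f x , Sat-cong Y φ (to-∷ x _ ρ (Eq.refl Y)) (⇔.to (Sat-≅ φ (x ∷ ρ)) s))
    (λ (y , s) → let (x , fx≈y) = to-surj f y in
                 x , ⇔.from (Sat-≅ φ (x ∷ ρ)) (Sat-cong Y φ (Eq.sym Y ∘ to-∷ x y ρ fx≈y) s))

translate : ∀ {σ τ} (I : Interp σ τ) → ∀ {n} → Formula τ n → Formula σ (n + params I)
translate I (relf R f) = rename (withParams f (params I)) (rels I R)
translate I (i ≐ j)    = rename (withParams (i ∷ j ∷ []) (params I)) (eq I)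
translate I ⊤f         = ⊤f
translate I ⊥f         = ⊥f
translate I (¬f φ)     = ¬f (translate I φ)
translate I (φ ∧f ψ)   = translate I φ ∧f translate I ψ
translate I (φ ∨f ψ)   = translate I φ ∨f translate I ψ
translate I (φ ⇒f ψ)   = translate I φ ⇒f translate I ψ
translate I {n} (∀f φ) = ∀f (insertAfterHead n (dom I) ⇒f translate I φ)
translate I {n} (∃f φ) = ∃f (insertAfterHead n (dom I) ∧f translate I φ)

module _ {σ τ : Signature} {ℓ : Level} (X : Structure σ ℓ) (L : InterpIn X τ) where

  private
    I = interp L
    ps = pars L

    env : ∀ {n} → Vector (Carrier (X ^ L)) n → Vector (Carrier X) (n + params I)
    env ρ = (proj₁ ∘ ρ) ++ ps

    env-∷ : ∀ {n} x (ρ : Vector (Carrier (X ^ L)) n) → env (x ∷ ρ) ≗ proj₁ x ∷ env ρ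
    env-∷ x ρ i =
      ≡.trans (++-cong _ _ (∘-∷ proj₁ x ρ) (λ _ → refl) i) (∷-++ (proj₁ x) (proj₁ ∘ ρ) ps i)

    Sat-dom : ∀ {n} a (ρ : Vector (Carrier (X ^ L)) n) →
              Sat X (insertAfterHead n (dom I)) (a ∷ env ρ) ⇔ Sat X (dom I) (a ∷ ps)
    Sat-dom a ρ = Sat-insertAfterHead X (dom I) a (proj₁ ∘ ρ) ps

  mutual
    Sat-translate : ∀ {n} (φ : Formula τ n) (ρ : Vector (Carrier (X ^ L)) n) →
                    Sat (X ^ L) φ ρ ⇔ Sat X (translate I φ) (env ρ)
    Sat-translate (relf R f) ρ =
      ⇔-sym (Sat-rename X _ (rels I R) (Eq.reflexive X ∘ withParams-++ f (proj₁ ∘ ρ) ps))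
    Sat-translate (i ≐ j) ρ =
      ⇔-sym (Sat-rename X _ (eq I) λ k →
        Eq.reflexive X (≡.trans (withParams-++ (i ∷ j ∷ []) (proj₁ ∘ ρ) ps k) (++-pair _ ps k)))
    Sat-translate ⊤f       ρ = ⇔-refl
    Sat-translate ⊥f       ρ = ⇔-refl
    Sat-translate (¬f φ)   ρ = →-cong-⇔ (Sat-translate φ ρ) ⇔-refl
    Sat-translate (φ ∧f ψ) ρ = Sat-translate φ ρ ×-⇔ Sat-translate ψ ρ
    Sat-translate (φ ∨f ψ) ρ = Sat-translate φ ρ ⊎-⇔ Sat-translate ψ ρ
    Sat-translate (φ ⇒f ψ) ρ = →-cong-⇔ (Sat-translate φ ρ) (Sat-translate ψ ρ)
    Sat-translate (∀f φ)   ρ = mk⇔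
      (λ s a d → ⇔.to (Sat-translate-∷ φ (a , ⇔.to (Sat-dom a ρ) d) ρ) (s _))
      (λ s (a , d) → ⇔.from (Sat-translate-∷ φ (a , d) ρ) (s a (⇔.from (Sat-dom a ρ) d)))
    Sat-translate (∃f φ)   ρ = mk⇔
      (λ ((a , d) , s) → a , ⇔.from (Sat-dom a ρ) d , ⇔.to (Sat-translate-∷ φ (a , d) ρ) s)
      (λ (a , d , s) → (a , ⇔.to (Sat-dom a ρ) d) , ⇔.from (Sat-translate-∷ φ _ ρ) s)

    Sat-translate-∷ : ∀ {n} (φ : Formula τ (1 + n)) x (ρ : Vector (Carrier (X ^ L)) n) →
                      Sat (X ^ L) φ (x ∷ ρ) ⇔ Sat X (translate I φ) (proj₁ x ∷ env ρ)
    Sat-translate-∷ φ x ρ = Sat-≗ X (translate I φ) (env-∷ x ρ) ⇔-∘ Sat-translate φ (x ∷ ρ)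

-- Unlike interpretations,
-- presentations are closed under interpreting further (_▸_); this is how an iterated
-- interpretation (A^N)^L is flattened into a single interpretation in A.
record Presentation {σ τ : Signature} {ℓ : Level}
                    (A : Structure σ ℓ) (X : Structure τ ℓ) : Set ℓ where
  field
    code       : Carrier X → Carrier A
    #params    : ℕ
    parameters : Vector (Carrier A) #params
    encode     : ∀ {n} → Formula τ n → Formula σ (n + #params)
    Sat-encode : ∀ {n} (φ : Formula τ n) (ρ : Vector (Carrier X) n) →
                 Sat X φ ρ ⇔ Sat A (encode φ) ((code ∘ ρ) ++ parameters)
    codes      : Formula σ (1 + #params)
    code∈codes : ∀ x → Sat A codes (code x ∷ parameters)
    decode     : ∀ a → Sat A codes (a ∷ parameters) → Σ (Carrier X) λ x → _≈_ A (code x) a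
open Presentation public

module _ {σ τ : Signature} {ℓ : Level} {A : Structure σ ℓ} {X : Structure τ ℓ}
         (P : Presentation A X) where

  encodeWith : ∀ {m k} → Formula τ (m + k) → Formula σ (m + (k + #params P))
  encodeWith {m} {k} φ = rename (reassoc m k (#params P)) (encode P φ)

  Sat-encodeWith : ∀ {m k} (φ : Formula τ (m + k))
                   (ρ : Vector (Carrier X) m) (ps : Vector (Carrier X) k) →
                   Sat X φ (ρ ++ ps) ⇔
                   Sat A (encodeWith {m} {k} φ) ((code P ∘ ρ) ++ ((code P ∘ ps) ++ parameters P))
  Sat-encodeWith φ ρ ps =
    ⇔-sym (Sat-rename A _ (encode P φ) λ i → Eq.reflexive A (≡.trans
      (reassoc-++ (code P ∘ ρ) (code P ∘ ps) (parameters P) i)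
      (++-cong _ _ (≡.sym ∘ map-++ (code P) ρ ps) (λ _ → refl) i)))
    ⇔-∘ Sat-encode P φ (ρ ++ ps)

  Sat-encodeWith₁ : ∀ {k} (φ : Formula τ (1 + k)) x (ps : Vector (Carrier X) k) →
                    Sat X φ (x ∷ ps) ⇔
                    Sat A (encodeWith {1} {k} φ) (code P x ∷ ((code P ∘ ps) ++ parameters P))
  Sat-encodeWith₁ {k} φ x ps =
    Sat-≗ A (encodeWith {1} {k} φ) (++-singleton _ _)
      ⇔-∘ (Sat-encodeWith φ (x ∷ []) ps ⇔-∘ Sat-≗ X φ (≡.sym ∘ ++-singleton (x ∷ []) ps))

  Sat-encodeWith₂ : ∀ {k} (φ : Formula τ (2 + k)) x y (ps : Vector (Carrier X) k) →
                    Sat X φ (x ∷ y ∷ ps) ⇔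
                    Sat A (encodeWith {2} {k} φ)
                          (code P x ∷ code P y ∷ ((code P ∘ ps) ++ parameters P))
  Sat-encodeWith₂ {k} φ x y ps =
    Sat-≗ A (encodeWith {2} {k} φ) (++-pair _ _)
      ⇔-∘ (Sat-encodeWith φ (x ∷ y ∷ []) ps ⇔-∘ Sat-≗ X φ (≡.sym ∘ ++-pair (x ∷ y ∷ []) ps))

viaIso : ∀ {σ ℓ} {X A : Structure σ ℓ} → X ≅ A → Presentation A X
viaIso {A = A} h = record
  { code       = to h
  ; #params    = 0
  ; parameters = []
  ; encode     = rename (_↑ˡ 0)
  ; Sat-encode = λ φ ρ →
      ⇔-sym (Sat-rename A _ φ (Eq.reflexive A ∘ lookup-++ˡ (to h ∘ ρ) [])) ⇔-∘ Sat-≅ h φ ρ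
  ; codes      = ⊤f
  ; code∈codes = λ _ → lift tt
  ; decode     = λ a _ → to-surj h a
  }

self : ∀ {σ ℓ} (A : Structure σ ℓ) → Presentation A A
self A = viaIso ≅-refl

infixl 5 _▸_

_▸_ : ∀ {σ τ ρ ℓ} {A : Structure σ ℓ} {X : Structure τ ℓ} →
      Presentation A X → (L : InterpIn X ρ) → Presentation A (X ^ L)
_▸_ {A = A} {X} P L = record
  { code       = code P ∘ proj₁
  ; #params    = params I + #params P
  ; parameters = (code P ∘ pars L) ++ parameters P
  ; encode     = λ {n} φ → encodeWith P {n} (translate I φ)
  ; Sat-encode = λ φ ρ →
      Sat-encodeWith P (translate I φ) (proj₁ ∘ ρ) (pars L) ⇔-∘ Sat-translate X L φ ρ
  ; codes      = insertAfterHead (params I) (codes P) ∧f domain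
  ; code∈codes = λ (x , d) →
      ⇔.from (Sat-outer (code P x)) (code∈codes P x) , ⇔.to (Sat-domain x) d
  ; decode     = λ a (c , d) →
      let (x , e) = decode P a (⇔.to (Sat-outer a) c)
      in (x , ⇔.from (Sat-domain x) (Sat-cong₁ A domain (Eq.sym A e) d)) , e
  }
  where
    I = interp L
    domain = encodeWith P {1} {params I} (dom I)
    Sat-outer = λ a → Sat-insertAfterHead A (codes P) a (code P ∘ pars L) (parameters P)
    Sat-domain = λ x → Sat-encodeWith₁ P (dom I) x (pars L)

module _ {σ : Signature} {k₀ k₁ k₂ : ℕ} where

  private
    K = k₁ + (k₂ + k₀)

    middle : Fin (1 + k₀) → Fin (3 + K)
    middle zero    = zero
    middle (suc i) = suc (suc (suc (k₁ ↑ʳ (k₂ ↑ʳ i))))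

    left : Fin (2 + k₁) → Fin (3 + K)
    left zero          = suc zero
    left (suc zero)    = zero
    left (suc (suc i)) = suc (suc (suc (i ↑ˡ (k₂ + k₀))))

    right : Fin (2 + k₂) → Fin (3 + K)
    right zero          = zero
    right (suc zero)    = suc (suc zero)
    right (suc (suc i)) = suc (suc (suc (k₁ ↑ʳ (i ↑ˡ k₀))))

  composeOver : Formula σ (1 + k₀) → Formula σ (2 + k₁) → Formula σ (2 + k₂) → Formula σ (2 + K)
  composeOver δ θ₁ θ₂ = ∃f (rename middle δ ∧f (rename left θ₁ ∧f rename right θ₂))

  module _ {ℓ : Level} (A : Structure σ ℓ) where

    Sat-composeOver : (δ : Formula σ (1 + k₀)) (θ₁ : Formula σ (2 + k₁)) (θ₂ : Formula σ (2 + k₂))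
                      (q₀ : Vector (Carrier A) k₀) (q₁ : Vector (Carrier A) k₁)
                      (q₂ : Vector (Carrier A) k₂) →
                      ∀ a c → Sat A (composeOver δ θ₁ θ₂) (a ∷ c ∷ (q₁ ++ (q₂ ++ q₀))) ⇔
                              Σ (Carrier A) λ b →
                                Sat A δ (b ∷ q₀) × Sat A θ₁ (a ∷ b ∷ q₁) × Sat A θ₂ (b ∷ c ∷ q₂)
    Sat-composeOver δ θ₁ θ₂ q₀ q₁ q₂ a c = Σ-cong-⇔ λ b →
      Sat-rename A middle δ (at-middle b)
        ×-⇔ (Sat-rename A left θ₁ (at-left b) ×-⇔ Sat-rename A right θ₂ (at-right b))
      where
        env : Carrier A → Vector (Carrier A) (3 + K)
        env b = b ∷ a ∷ c ∷ (q₁ ++ (q₂ ++ q₀))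

        at-middle : ∀ b → Pointwise (_≈_ A) (env b ∘ middle) (b ∷ q₀)
        at-middle b zero    = Eq.refl A
        at-middle b (suc i) =
          Eq.reflexive A (≡.trans (lookup-++ʳ q₁ _ (k₂ ↑ʳ i)) (lookup-++ʳ q₂ q₀ i))

        at-left : ∀ b → Pointwise (_≈_ A) (env b ∘ left) (a ∷ b ∷ q₁)
        at-left b zero          = Eq.refl A
        at-left b (suc zero)    = Eq.refl A
        at-left b (suc (suc i)) = Eq.reflexive A (lookup-++ˡ q₁ _ i)

        at-right : ∀ b → Pointwise (_≈_ A) (env b ∘ right) (b ∷ c ∷ q₂)
        at-right b zero          = Eq.refl A
        at-right b (suc zero)    = Eq.refl A
        at-right b (suc (suc i)) =
          Eq.reflexive A (≡.trans (lookup-++ʳ q₁ _ (i ↑ˡ k₀)) (lookup-++ˡ q₂ q₀ i))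

record Definable≅ {σ τ : Signature} {ℓ : Level} (A : Structure σ ℓ) (X Y : Structure τ ℓ)
                  (uX : Carrier X → Carrier A) (uY : Carrier Y → Carrier A) : Set ℓ where
  constructor definable≅
  field
    iso       : X ≅ Y
    definable : DefinableIso A uX uY iso
open Definable≅ public

module _ {σ τ : Signature} {ℓ : Level} {A : Structure σ ℓ} {X Y : Structure τ ℓ}
         {uX : Carrier X → Carrier A} {uY : Carrier Y → Carrier A} where

  definableByGraph : (f : X ≅ Y) → ∀ {k} (θ : Formula σ (2 + k)) (q : Vector (Carrier A) k) →
                     (∀ x y → _≈_ Y (to f x) y ⇔ Sat A θ (uX x ∷ uY y ∷ q)) →
                     Definable≅ A X Y uX uY
  definableByGraph f θ q graph =
    definable≅ f (_ , θ , q , λ x y → ⇔.to (graph x y) , ⇔.from (graph x y))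

module _ {σ τ : Signature} {ℓ : Level} {A : Structure σ ℓ} {Y : Structure τ ℓ}
         (P : Presentation A Y) where

  private
    q = parameters P

    ε : Formula σ (2 + #params P)
    ε = encode P (zero ≐ suc zero)

    E : Carrier A → Carrier A → Set ℓ
    E a b = Sat A ε (a ∷ b ∷ q)

    D : Carrier A → Set ℓ
    D a = Sat A (codes P) (a ∷ q)

    ≈⇔E : ∀ y y′ → _≈_ Y y y′ ⇔ E (code P y) (code P y′)
    ≈⇔E y y′ = Sat-≗ A ε (++-pair _ q) ⇔-∘ Sat-encode P (zero ≐ suc zero) (y ∷ y′ ∷ [])

    E-cong : ∀ {a a′ b b′} → _≈_ A a a′ → _≈_ A b b′ → E a b → E a′ b′
    E-cong = Sat-cong₂ A ε

    dec : ∀ {a} → D a → Carrier Y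
    dec {a} d = proj₁ (decode P a d)

    code-dec : ∀ {a} (d : D a) → _≈_ A (code P (dec d)) a
    code-dec {a} d = proj₂ (decode P a d)

    E⇔≈ : ∀ {a b} (da : D a) (db : D b) → E a b ⇔ _≈_ Y (dec da) (dec db)
    E⇔≈ da db = mk⇔
      (⇔.from (≈⇔E _ _) ∘ E-cong (Eq.sym A (code-dec da)) (Eq.sym A (code-dec db)))
      (E-cong (code-dec da) (code-dec db) ∘ ⇔.to (≈⇔E _ _))

    Sat-rel : ∀ R (xs : Vector (Carrier A) (arity τ R)) (dx : ∀ i → D (xs i)) →
              Sat A (encode P (relf R id)) (xs ++ q) ⇔ rel Y R (dec ∘ dx)
    Sat-rel R xs dx =
      ⇔-sym (Sat-encode P (relf R id) (dec ∘ dx))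
      ⇔-∘ Sat-cong-⇔ A (encode P (relf R id))
            (++⁺ (_≈_ A) (Eq.sym A ∘ code-dec ∘ dx) λ _ → Eq.refl A)

    I : Interp σ τ
    I = record { params = #params P ; dom = codes P ; eq = ε ; rels = λ R → encode P (relf R id) }

    isInterp′ : IsInterpIn A I q
    isInterp′ = record
      { E-refl    = λ a da → ⇔.from (E⇔≈ da da) (Eq.refl Y)
      ; E-sym     = λ a b da db → ⇔.from (E⇔≈ db da) ∘ Eq.sym Y ∘ ⇔.to (E⇔≈ da db)
      ; E-trans   = λ a b c da db dc ab bc →
          ⇔.from (E⇔≈ da dc) (Eq.trans Y (⇔.to (E⇔≈ da db) ab) (⇔.to (E⇔≈ db dc) bc))
      ; rels-cong = λ R xs ys dx dy xs≈ys →
          ⇔.from (Sat-rel R ys dy) ∘ rel-cong Y R _ _ (λ i → ⇔.to (E⇔≈ (dx i) (dy i)) (xs≈ys i))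
          ∘ ⇔.to (Sat-rel R xs dx)
      }

  interpretation : InterpIn A τ
  interpretation = record { interp = I ; pars = q ; isInterp = isInterp′ }

  interpretation-≅ : Y ≅ (A ^ interpretation)
  interpretation-≅ = record
    { to       = λ y → code P y , code∈codes P y
    ; to-cong  = ⇔.to (≈⇔E _ _)
    ; to-inj   = ⇔.from (≈⇔E _ _)
    ; to-surj  = λ (a , d) → dec d , E-cong (Eq.refl A) (code-dec d) (⇔.to (≈⇔E _ _) (Eq.refl Y))
    ; to-rel   = λ R ys → ⇔.to (Sat-encode P (relf R id) ys)
    ; from-rel = λ R ys → ⇔.from (Sat-encode P (relf R id) ys)
    }

  interpretation-≅-definable : Definable≅ A Y (A ^ interpretation) (code P) proj₁
  interpretation-≅-definable = definable≅ interpretation-≅ (#params P , ε , q , λ _ _ → id , id)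

module _ {σ τ : Signature} {ℓ : Level} {A : Structure σ ℓ} {X Y Z : Structure τ ℓ}
         {uX : Carrier X → Carrier A} {uZ : Carrier Z → Carrier A} where

  infixr 4 ≅-trans-definable
  syntax ≅-trans-definable PY d e = d ⨾⟨ PY ⟩ e

  ≅-trans-definable : (PY : Presentation A Y) →
                      Definable≅ A X Y uX (code PY) → Definable≅ A Y Z (code PY) uZ →
                      Definable≅ A X Z uX uZ
  ≅-trans-definable PY (definable≅ f (_ , θ , q , F)) (definable≅ g (_ , θ′ , q′ , G)) =
    definableByGraph (≅-trans f g) (composeOver (codes PY) θ θ′) _ λ x z →
      ⇔-sym (Sat-composeOver A (codes PY) θ θ′ (parameters PY) q q′ (uX x) (uZ z)) ⇔-∘ mk⇔
        (λ gfx≈z → code PY (to f x) , code∈codes PY (to f x) ,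
                   proj₁ (F x _) (Eq.refl Y) , proj₁ (G _ z) gfx≈z)
        (λ (b , d , s , s′) → let (y , y≈b) = decode PY b d in
          Eq.trans Z (to-cong g (proj₂ (F x y) (Sat-cong₂ A θ (Eq.refl A) (Eq.sym A y≈b) s)))
                     (proj₂ (G y z) (Sat-cong₂ A θ′ (Eq.sym A y≈b) (Eq.refl A) s′)))

module _ {σ ρ τ : Signature} {ℓ : Level}
         {A : Structure σ ℓ} {B : Structure ρ ℓ} {X Y : Structure τ ℓ}
         {uX : Carrier X → Carrier B} {uY : Carrier Y → Carrier B} where

  definable-down : (P : Presentation A B) →
                   Definable≅ B X Y uX uY → Definable≅ A X Y (code P ∘ uX) (code P ∘ uY)
  definable-down P (definable≅ f (_ , θ , q , F)) =
    definableByGraph f (encodeWith P {2} θ) ((code P ∘ q) ++ parameters P) λ x y →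
      Sat-encodeWith₂ P θ (uX x) (uY y) q ⇔-∘ mk⇔ (proj₁ (F x y)) (proj₂ (F x y))

module _ {σ : Signature} {ℓ : Level} {X B : Structure σ ℓ} where

  ≅-definable : (h : X ≅ B) → Definable≅ B X B (to h) id
  ≅-definable h = definableByGraph h (zero ≐ suc zero) [] λ _ _ → ⇔-refl

  ≅-sym-definable : (h : X ≅ B) → Definable≅ B B X id (to h)
  ≅-sym-definable h = definableByGraph (≅-sym h) (zero ≐ suc zero) [] λ b x → mk⇔
    (λ e → Eq.trans B (Eq.sym B (proj₂ (to-surj h b))) (to-cong h e))
    (λ b≈hx → to-inj h (Eq.trans B (proj₂ (to-surj h b)) b≈hx))

-- transport and _⊙_ are opaque, so that the conversion checker compares such
-- interpretations by their arguments instead of normalising the translated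
-- formulas, which makes checking the constructions below prohibitively slow.
module _ {τ ρ : Signature} {ℓ : Level} {X Y : Structure τ ℓ} where

  opaque
    transport : X ≅ Y → InterpIn X ρ → InterpIn Y ρ
    transport h L = interpretation (viaIso h ▸ L)

    transport-≅ : (h : X ≅ Y) (L : InterpIn X ρ) → (X ^ L) ≅ (Y ^ transport h L)
    transport-≅ h L = interpretation-≅ (viaIso h ▸ L)

    transport-≅-definable :
      ∀ {σ} {A : Structure σ ℓ} (PX : Presentation A X) (PY : Presentation A Y)
      (d : Definable≅ A X Y (code PX) (code PY)) (L : InterpIn X ρ) →
      Definable≅ A (X ^ L) (Y ^ transport (iso d) L) (code (PX ▸ L)) (code (PY ▸ transport (iso d) L))
    transport-≅-definable {σ} {A} PX PY (definable≅ h (_ , θ , q , H)) L =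
      definableByGraph (transport-≅ h L) (composeOver (codes PY) θ ε′) _ λ x w →
        ⇔-sym (Sat-composeOver A (codes PY) θ ε′ (parameters PY) q q′
                               (code PX (proj₁ x)) (code PY (proj₁ w)))
        ⇔-∘ mk⇔
          (λ hx≈w → code PY (to h (proj₁ x)) , code∈codes PY _ , proj₁ (H _ _) (Eq.refl Y) ,
                    ⇔.to (Sat-encodeWith₂ PY ε _ _ (pars L′)) hx≈w)
          (λ (b , d , s , s′) →
            let (y , y≈b) = decode PY b d
                hx≈y = proj₂ (H _ y) (Sat-cong₂ A θ (Eq.refl A) (Eq.sym A y≈b) s)
                εyw  = ⇔.from (Sat-encodeWith₂ PY ε y _ (pars L′))
                              (Sat-cong₂ A ε′ (Eq.sym A y≈b) (Eq.refl A) s′)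
            in Sat-cong₂ Y ε (Eq.sym Y hx≈y) (Eq.refl Y) εyw)
      where
        L′ : InterpIn Y ρ
        L′ = transport h L
        ε : Formula τ (2 + params (interp L′))
        ε = eq (interp L′)
        ε′ : Formula σ (2 + (params (interp L′) + #params PY))
        ε′ = encodeWith PY {2} ε
        q′ : Vector (Carrier A) (params (interp L′) + #params PY)
        q′ = (code PY ∘ pars L′) ++ parameters PY

module _ {σ τ ρ : Signature} {ℓ : Level} {M : Structure σ ℓ} where

  opaque
    _⊙_ : (N : InterpIn M τ) → InterpIn (M ^ N) ρ → InterpIn M ρ
    N ⊙ L = interpretation (self M ▸ N ▸ L)

    ⊙-≅-definable : (N : InterpIn M τ) (L : InterpIn (M ^ N) ρ) →
                    Definable≅ M ((M ^ N) ^ L) (M ^ (N ⊙ L)) (code (self M ▸ N ▸ L)) proj₁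
    ⊙-≅-definable N L = interpretation-≅-definable (self M ▸ N ▸ L)

retraction-definable : ∀ {σ τ ℓ} {M : Structure σ ℓ} (r : Retraction M τ) →
                       Definable≅ M M ((M ^ N r) ^ M′ r) id (under₂ {M = M} {N = N r} {K = M′ r})
retraction-definable r = definable≅ (ι r) (ι-definable r)

module _ {σ τ ρ : Signature} {ℓ : Level} {M : Structure σ ℓ} where

  composeRetractions : (r : Retraction M τ) → Retraction (M ^ N r) ρ → Retraction M ρ
  composeRetractions r r′ = record
    { N = N r ⊙ N r′ ; M′ = back′ ; ι = iso ιᵈ ; ι-definable = definable ιᵈ }
    where
      M₁ = M ^ N r
      G = M₁ ^ N r′
      -- G interprets M^N by M′ r′, in which M is interpreted by M′ r moved along ι r′.
      moved = transport (ι r′) (M′ r)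
      back = M′ r′ ⊙ moved
      back′ = transport (iso (⊙-≅-definable (N r) (N r′))) back

      ιᵈ : Definable≅ M M ((M ^ (N r ⊙ N r′)) ^ back′)
                          id (code (self M ▸ (N r ⊙ N r′) ▸ back′))
      ιᵈ = retraction-definable r
           ⨾⟨ self M ▸ N r ▸ M′ r ⟩
           definable-down (self M ▸ N r)
             (transport-≅-definable (self M₁) (self M₁ ▸ N r′ ▸ M′ r′)
                (retraction-definable r′) (M′ r))
           ⨾⟨ self M ▸ N r ▸ N r′ ▸ M′ r′ ▸ moved ⟩
           definable-down (self M ▸ N r ▸ N r′) (⊙-≅-definable (M′ r′) moved)
           ⨾⟨ self M ▸ N r ▸ N r′ ▸ back ⟩
           transport-≅-definable (self M ▸ N r ▸ N r′) (self M ▸ (N r ⊙ N r′))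
             (⊙-≅-definable (N r) (N r′)) back

module _ {σ τ : Signature} {ℓ : Level} {M B : Structure σ ℓ} where

  transportRetraction : M ≅ B → Retraction M τ → Retraction B τ
  transportRetraction h r = record
    { N = transport h (N r) ; M′ = moved ; ι = iso ιᵈ ; ι-definable = definable ιᵈ }
    where
      N-≅ = transport-≅-definable (viaIso h) (self B) (≅-definable h) (N r)
      moved = transport (iso N-≅) (M′ r)

      ιᵈ : Definable≅ B B ((B ^ transport h (N r)) ^ moved)
                          id (code (self B ▸ transport h (N r) ▸ moved))
      ιᵈ = ≅-sym-definable h
           ⨾⟨ viaIso h ⟩
           definable-down (viaIso h) (retraction-definable r)
           ⨾⟨ viaIso h ▸ N r ▸ M′ r ⟩
           transport-≅-definable (viaIso h ▸ N r) (self B ▸ transport h (N r)) N-≅ (M′ r)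

converseRetraction : ∀ {σ τ ℓ} {M : Structure σ ℓ} (b : BiInterpretation M τ) →
                     Retraction (M ^ N (retraction b)) σ
converseRetraction b = record
  { N = M′ (retraction b) ; M′ = movedN b ; ι = κ b ; ι-definable = κ-definable b }

proposition4p13 :
    ∀ {ℓ} {σ τN τK τG : Signature} (M : Structure σ ℓ)
      (rN : Retraction M τN) (bK : BiInterpretation M τK)
      (rG : Retraction (M ^ N rN) τG) (G : Structure τG ℓ) →
      G ≅ ((M ^ N rN) ^ N rG) →
      Σ (Retraction (M ^ N (retraction bK)) τG) λ rK →
        (((M ^ N (retraction bK)) ^ N rK) ≅ G) ×
        Σ (Iso ((M ^ N rN) ^ N rG) ((M ^ N (retraction bK)) ^ N rK)) λ f →
          DefinableIso M
            (under₂ {M = M} {N = N rN} {K = N rG})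
            (under₂ {M = M} {N = N (retraction bK)} {K = N rK}) f
proposition4p13 M rN bK rG G G≅G′ =
  rK , ≅-trans (≅-sym (iso f)) (≅-sym G≅G′) , iso f , definable f
  where
    rK₀ = retraction bK
    rNG = composeRetractions rN rG
    rB  = transportRetraction (ι rK₀) rNG
    rK  = composeRetractions (converseRetraction bK) rB

    f : Definable≅ M ((M ^ N rN) ^ N rG) ((M ^ N rK₀) ^ N rK)
                     (code (self M ▸ N rN ▸ N rG)) (code (self M ▸ N rK₀ ▸ N rK))
    f = ⊙-≅-definable (N rN) (N rG)
        ⨾⟨ self M ▸ N rNG ⟩
        transport-≅-definable (self M) (self M ▸ N rK₀ ▸ M′ rK₀) (retraction-definable rK₀) (N rNG)
        ⨾⟨ self M ▸ N rK₀ ▸ M′ rK₀ ▸ N rB ⟩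
        definable-down (self M ▸ N rK₀) (⊙-≅-definable (M′ rK₀) (N rB))
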